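{- Let $\alpha>0$ be a real number and let $n,m\ge1$ be integers. Let $G'$ be obtained from a $3$-regular $\alpha$-expander $G$ on $n$ vertices by subdividing each edge at most $m$ times, and let $n'=|V(G')|$. Then every balanced separation in $G'$ has size at least $\frac{n'}{3(1+3m/2)(6/\alpha+2)}$.
   Context: A graph $G$ is an $\alpha$-expander if for every $S\subseteq V(G)$ with $|S|\le|V(G)|/2$ there are at least $\alpha|S|$ edges of $G$ with exactly one end in $S$. A separation of a graph $G$ is a pair $(A,B)$ of edge-disjoint subgraphs with $A\cup B=G$; its size is $|V(A)\cap V(B)|$; it is balanced if $|V(A)\setminus V(B)|\le2|V(G)|/3$ and $|V(B)\setminus V(A)|\le2|V(G)|/3$.
   Formalization: The parameter α ranges over the positive rationals instead of the positive reals. -}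

module Defs where

open import Data.Nat as ℕ using (ℕ; zero; suc; _+_)
open import Data.Bool using (Bool; true; false; if_then_else_; _∧_; not)
open import Data.Fin using (Fin; toℕ) renaming (zero to fzero; suc to fsuc; _<_ to _<ᶠ_)
open import Data.Fin.Subset using (Subset; _∈_; _∩_; _─_; ∣_∣)
open import Data.Vec using (lookup)
open import Data.Product using (Σ; Σ-syntax; ∃; ∃-syntax; _×_; _,_)
open import Data.Sum using (_⊎_; inj₁; inj₂)
open import Data.Integer using (+_)
open import Data.Rational using (ℚ; _/_; _÷_; 1/_; _≤_; Positive; NonZero)
  renaming (_+_ to _+ℚ_; _*_ to _*ℚ_)
open import Data.Rational.Properties using (pos⇒nonZero; pos*pos⇒pos; pos+pos⇒pos;
  pos+nonNeg⇒pos; 1/pos⇒pos; normalize-nonNeg)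
open import Relation.Binary.PropositionalEquality using (_≡_)
open import Relation.Nullary using (¬_)
open import Function.Bundles using (_↔_; _⇔_; Inverse)

record Graph (n : ℕ) : Set where
  field
    adj    : Fin n → Fin n → Bool
    sym    : ∀ i j → adj i j ≡ adj j i
    irrefl : ∀ i → adj i i ≡ false
open Graph public

sumF : ∀ {n} → (Fin n → ℕ) → ℕ
sumF {zero}  f = 0
sumF {suc n} f = f fzero + sumF (λ i → f (fsuc i))

countB : ∀ {n} → (Fin n → Bool) → ℕ
countB b = sumF (λ i → if b i then 1 else 0)

degree : ∀ {n} → Graph n → Fin n → ℕ
degree G i = countB (adj G i)

Regular : ∀ {n} → ℕ → Graph n → Set
Regular d G = ∀ i → degree G i ≡ d

boundary : ∀ {n} → Graph n → Subset n → ℕ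
boundary G S =
  sumF (λ i → if lookup S i
                then countB (λ j → adj G i j ∧ not (lookup S j))
                else 0)

ℕtoℚ : ℕ → ℚ
ℕtoℚ k = + k / 1

Expander : ∀ {n} → ℚ → Graph n → Set
Expander {n} α G =
  (S : Subset n) → 2 ℕ.* ∣ S ∣ ℕ.≤ n → α *ℚ ℕtoℚ ∣ S ∣ ≤ ℕtoℚ (boundary G S)

-- (A , B): subgraphs A = (VA, EA), B = (VB, EB) of G (edge sets given as
-- symmetric sets of adjacent ordered pairs), edge-disjoint, with A ∪ B = G.
record Separation {n} (G : Graph n) : Set where
  field
    VA VB : Subset n
    EA EB : Fin n → Fin n → Bool
    EA-sym  : ∀ i j → EA i j ≡ EA j i
    EB-sym  : ∀ i j → EB i j ≡ EB j i
    EA-edge : ∀ i j → EA i j ≡ true → adj G i j ≡ true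
    EB-edge : ∀ i j → EB i j ≡ true → adj G i j ≡ true
    EA-ends : ∀ i j → EA i j ≡ true → i ∈ VA × j ∈ VA
    EB-ends : ∀ i j → EB i j ≡ true → i ∈ VB × j ∈ VB
    cover-V : ∀ i → i ∈ VA ⊎ i ∈ VB
    cover-E : ∀ i j → adj G i j ≡ true → EA i j ≡ true ⊎ EB i j ≡ true
    disjoint : ∀ i j → ¬ (EA i j ≡ true × EB i j ≡ true)
open Separation public

size : ∀ {n} {G : Graph n} → Separation G → ℕ
size s = ∣ VA s ∩ VB s ∣

Balanced : ∀ {n} {G : Graph n} → Separation G → Set
Balanced {n} s =
  (3 ℕ.* ∣ VA s ─ VB s ∣ ℕ.≤ 2 ℕ.* n) × (3 ℕ.* ∣ VB s ─ VA s ∣ ℕ.≤ 2 ℕ.* n)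

-- vertex set of the graph obtained from G by subdividing the edge {i,j}
-- (i < j) exactly k i j times: original vertices plus k i j new vertices
-- per edge.
SubV : ∀ {n} → Graph n → (Fin n → Fin n → ℕ) → Set
SubV {n} G k =
  Fin n ⊎ (Σ[ i ∈ Fin n ] Σ[ j ∈ Fin n ]
             (i <ᶠ j) × (adj G i j ≡ true) × Fin (k i j))

-- OnPath G k i j u p : u is the vertex at position p of the path
-- i = p₀, p₁, …, p_{k i j}, p_{k i j + 1} = j replacing edge {i,j}.
data OnPath {n} (G : Graph n) (k : Fin n → Fin n → ℕ) (i j : Fin n)
            : SubV G k → ℕ → Set where
  start : OnPath G k i j (inj₁ i) 0
  end   : OnPath G k i j (inj₁ j) (suc (k i j))
  mid   : ∀ lt e (t : Fin (k i j)) →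
          OnPath G k i j (inj₂ (i , j , lt , e , t)) (suc (toℕ t))

SubAdj : ∀ {n} (G : Graph n) (k : Fin n → Fin n → ℕ) → SubV G k → SubV G k → Set
SubAdj {n} G k u v =
  Σ[ i ∈ Fin n ] Σ[ j ∈ Fin n ] (i <ᶠ j) × (adj G i j ≡ true) ×
    Σ[ p ∈ ℕ ] Σ[ q ∈ ℕ ]
      OnPath G k i j u p × OnPath G k i j v q × (suc p ≡ q ⊎ suc q ≡ p)

IsSubdivision : ∀ {n n'} → ℕ → Graph n → Graph n' → Set
IsSubdivision {n} {n'} m G G' =
  Σ[ k ∈ (Fin n → Fin n → ℕ) ] (∀ i j → k i j ℕ.≤ m) ×
    Σ[ f ∈ (Fin n' ↔ SubV G k) ]
      (∀ u v → (adj G' u v ≡ true) ⇔ SubAdj G k (Inverse.to f u) (Inverse.to f v))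

module _ (α : ℚ) .{{αpos : Positive α}} (m : ℕ) where
  sixOverα : ℚ
  sixOverα = _÷_ (+ 6 / 1) α {{pos⇒nonZero α}}

  factor₁ : ℚ
  factor₁ = + 3 / 1

  factor₂ : ℚ
  factor₂ = (+ 1 / 1) +ℚ (+ (3 ℕ.* m) / 2)

  factor₃ : ℚ
  factor₃ = sixOverα +ℚ (+ 2 / 1)

  denom : ℚ
  denom = factor₁ *ℚ factor₂ *ℚ factor₃

  private
    pos₃ : Positive factor₃
    pos₃ = pos+pos⇒pos sixOverα {{pos*pos⇒pos (+ 6 / 1) (1/_ α {{pos⇒nonZero α}}) {{1/pos⇒pos α}}}} (+ 2 / 1)
    pos₂ : Positive factor₂
    pos₂ = pos+nonNeg⇒pos (+ 1 / 1) (+ (3 ℕ.* m) / 2) {{normalize-nonNeg (3 ℕ.* m) 2}}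
    posD : Positive denom
    posD = pos*pos⇒pos (factor₁ *ℚ factor₂) {{pos*pos⇒pos factor₁ factor₂ {{pos₂}}}} factor₃ {{pos₃}}

  bound : ℕ → ℚ
  bound n' = _÷_ (ℕtoℚ n') denom {{pos⇒nonZero denom {{posD}}}}

-- Let (A, B) be a balanced separation of G′ with separator X = V(A) ∩ V(B). Every edge of G′
-- lies in A or in B, so a path of G′ avoiding X stays inside A ∖ B or inside B ∖ A. Let S be the
-- set of branch vertices (vertices of G) in B ∖ A, swapping A and B if necessary so that
-- |S| ≤ n/2. The subdivided path of an edge of G leaving S must meet X, and a vertex of X lies on
-- at most three such paths, so |∂S| ≤ 3|X| and expansion gives α|S| ≤ 3|X|. Likewise a path with
-- an interior vertex in B ∖ A starts in S or meets X, and it has at most m interior vertices,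
-- whence |B ∖ A| ≤ |S| + 3m(|S| + |X|). Balance gives n′ ≤ 3(|B ∖ A| + |X|)
-- ≤ 3(1 + 3m)(|S| + |X|), and |S| ≤ 3|X|/α turns this into the stated bound.

module Submission where

open import Defs renaming (sym to adj-sym)
open import Data.Nat as ℕ using (ℕ; zero; suc; _+_; _*_; _≤_; _<_; z≤n; s≤s; s≤s⁻¹; _<?_)
open import Data.Nat.Properties
open import Data.Nat.Tactic.RingSolver using (solve-∀)
open import Algebra.Properties.Semiring.Sum +-*-semiring
  using (sum; sum-cong-≗; sum-replicate-zero; ∑-distrib-+; ∑-comm; *-distribˡ-sum)
import Data.Integer as ℤ
import Data.Integer.Properties as ℤ
import Data.Integer.Tactic.RingSolver as ℤ
open import Data.Rational using (ℚ; Positive; NonNegative; _/_; 1/_; toℚᵘ) renaming (_≤_ to _≤ℚ_)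
import Data.Rational as ℚ
import Data.Rational.Properties as ℚ
open import Data.Rational.Solver using (module +-*-Solver)
open import Data.Rational.Unnormalised as ℚᵘ using (ℚᵘ; mkℚᵘ; *≡*; *≤*) renaming (_≃_ to _≃ᵘ_)
import Data.Rational.Unnormalised.Properties as ℚᵘ
open import Data.Bool as Bool using (Bool; true; false; if_then_else_; _∧_; not; _xor_)
open import Data.Bool.Properties using (xor-same; ∧-zeroʳ; ∧-identityʳ; ∧-comm)
open import Data.Fin using (Fin; toℕ; fromℕ<) renaming (zero to fzero; suc to fsuc; _<_ to _<ᶠ_)
import Data.Fin.Properties as Fin
open import Data.Fin.Subset using (Subset; ∣_∣; _∩_; _─_)
open import Data.Vec using ([]; _∷_; lookup; tabulate)
open import Data.Vec.Properties using (lookup∘tabulate; lookup-zipWith; []=⇒lookup)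
open import Data.Maybe using (Maybe; just; nothing; maybe′)
open import Data.Product using (_×_; _,_; proj₁; proj₂)
open import Data.Sum using (_⊎_; inj₁; inj₂; swap; [_,_]′)
import Data.Sum as Sum
open import Function using (_∘_; const)
open import Function.Bundles using (_↔_; _⇔_; Inverse; Equivalence)
open import Relation.Binary.PropositionalEquality
open import Relation.Binary.Definitions using (tri<; tri≈; tri>)
open import Relation.Nullary using (¬_; yes; no; does; contradiction)
open import Relation.Nullary.Decidable using (dec⇒maybe; _×-dec_)
open import Axiom.UniquenessOfIdentityProofs using (module Decidable⇒UIP)

𝟙 : Bool → ℕ
𝟙 b = if b then 1 else 0

𝟙≤1 : ∀ b → 𝟙 b ≤ 1
𝟙≤1 true  = s≤s z≤n
𝟙≤1 false = z≤n

𝟙≡0⇒false : ∀ {b} → 𝟙 b ≡ 0 → b ≡ false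
𝟙≡0⇒false {false} _ = refl

𝟙-∧ : ∀ a b → 𝟙 (a ∧ b) ≡ 𝟙 a * 𝟙 b
𝟙-∧ true  b = sym (+-identityʳ (𝟙 b))
𝟙-∧ false b = refl

𝟙-xor : ∀ a b → 𝟙 (a ∧ not b) + 𝟙 (b ∧ not a) ≡ 𝟙 (a xor b)
𝟙-xor true  true  = refl
𝟙-xor true  false = refl
𝟙-xor false true  = refl
𝟙-xor false false = refl

a≤m∧[c≡0⇒a≡0]⇒a≤m*c : ∀ {a} m c → a ≤ m → (c ≡ 0 → a ≡ 0) → a ≤ m * c
a≤m∧[c≡0⇒a≡0]⇒a≤m*c m zero    _   c≡0⇒a≡0 = ≤-reflexive (trans (c≡0⇒a≡0 refl) (sym (*-zeroʳ m)))
a≤m∧[c≡0⇒a≡0]⇒a≤m*c m (suc c) a≤m _       = ≤-trans a≤m (m≤m*n m (suc c))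

3a≤2[a+b]⇒a+b≤3b : ∀ a b → 3 * a ≤ 2 * (a + b) → a + b ≤ 3 * b
3a≤2[a+b]⇒a+b≤3b a b 3a≤2[a+b] = begin
  a + b      ≤⟨ +-monoˡ-≤ b (+-cancelˡ-≤ (2 * a) a (2 * b) (begin
    2 * a + a        ≡⟨ 2x+x≡3x a ⟩
    3 * a            ≤⟨ 3a≤2[a+b] ⟩
    2 * (a + b)      ≡⟨ *-distribˡ-+ 2 a b ⟩
    2 * a + 2 * b    ∎)) ⟩
  2 * b + b  ≡⟨ 2x+x≡3x b ⟩
  3 * b      ∎
  where
  open ≤-Reasoning
  2x+x≡3x : ∀ x → 2 * x + x ≡ 3 * x
  2x+x≡3x = solve-∀

a+b≤n⇒2a≤n⊎2b≤n : ∀ a b {n} → a + b ≤ n → 2 * a ≤ n ⊎ 2 * b ≤ n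
a+b≤n⇒2a≤n⊎2b≤n a b {n} a+b≤n with ≤-total a b
... | inj₁ a≤b = inj₁ (≤-trans (+-monoʳ-≤ a (subst (_≤ b) (sym (+-identityʳ a)) a≤b)) a+b≤n)
... | inj₂ b≤a = inj₂ (≤-trans (+-monoʳ-≤ b (subst (_≤ a) (sym (+-identityʳ b)) b≤a))
                               (subst (_≤ n) (+-comm a b) a+b≤n))

sumF≡sum : ∀ {n} (f : Fin n → ℕ) → sumF f ≡ sum f
sumF≡sum {zero}  f = refl
sumF≡sum {suc n} f = cong (f fzero +_) (sumF≡sum (f ∘ fsuc))

sum-mono-≤ : ∀ {n} {f g : Fin n → ℕ} → (∀ i → f i ≤ g i) → sum f ≤ sum g
sum-mono-≤ {zero}  f≤g = z≤n
sum-mono-≤ {suc n} f≤g = +-mono-≤ (f≤g fzero) (sum-mono-≤ (f≤g ∘ fsuc))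

sum-zero : ∀ {n} {f : Fin n → ℕ} → (∀ i → f i ≡ 0) → sum f ≡ 0
sum-zero {n} f≡0 = trans (sum-cong-≗ f≡0) (sum-replicate-zero n)

sum≡0⇒zero : ∀ {n} (f : Fin n → ℕ) → sum f ≡ 0 → ∀ i → f i ≡ 0
sum≡0⇒zero f sum≡0 fzero    = m+n≡0⇒m≡0 (f fzero) sum≡0
sum≡0⇒zero f sum≡0 (fsuc i) = sum≡0⇒zero (f ∘ fsuc) (m+n≡0⇒n≡0 (f fzero) sum≡0) i

sum-single : ∀ {n} (f : Fin n → ℕ) (i₀ : Fin n) → (∀ i → i ≢ i₀ → f i ≡ 0) → sum f ≡ f i₀
sum-single f fzero f≡0 =
  trans (cong (f fzero +_) (sum-zero (λ i → f≡0 (fsuc i) λ ()))) (+-identityʳ (f fzero))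
sum-single f (fsuc i₀) f≡0 = cong₂ _+_ (f≡0 fzero λ ())
  (sum-single (f ∘ fsuc) i₀ (λ i i≢i₀ → f≡0 (fsuc i) (i≢i₀ ∘ Fin.suc-injective)))

∑𝟙≤n : ∀ {n} (b : Fin n → Bool) → sum (𝟙 ∘ b) ≤ n
∑𝟙≤n {zero}  b = z≤n
∑𝟙≤n {suc n} b = +-mono-≤ (𝟙≤1 (b fzero)) (∑𝟙≤n (b ∘ fsuc))

∑1≡n : ∀ n → sum {n} (const 1) ≡ n
∑1≡n zero    = refl
∑1≡n (suc n) = cong suc (∑1≡n n)

∑𝟙+∑𝟙≤n : ∀ {n} (a b : Fin n → Bool) → (∀ i → a i ∧ b i ≡ false) → sum (𝟙 ∘ a) + sum (𝟙 ∘ b) ≤ n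
∑𝟙+∑𝟙≤n {n} a b disjoint = begin
  sum (𝟙 ∘ a) + sum (𝟙 ∘ b)      ≡⟨ sym (∑-distrib-+ (𝟙 ∘ a) (𝟙 ∘ b)) ⟩
  sum (λ i → 𝟙 (a i) + 𝟙 (b i))  ≤⟨ sum-mono-≤ (λ i → at-most-one (a i) (b i) (disjoint i)) ⟩
  sum {n} (const 1)              ≡⟨ ∑1≡n n ⟩
  n                              ∎
  where
  open ≤-Reasoning
  at-most-one : ∀ x y → x ∧ y ≡ false → 𝟙 x + 𝟙 y ≤ 1
  at-most-one true  true  ()
  at-most-one true  false _ = s≤s z≤n
  at-most-one false y     _ = 𝟙≤1 y

∑∑-distrib-+ : ∀ {m n} (f g : Fin m → Fin n → ℕ) →
  sum (λ i → sum (λ j → f i j + g i j)) ≡ sum (λ i → sum (f i)) + sum (λ i → sum (g i))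
∑∑-distrib-+ f g = trans (sum-cong-≗ (λ i → ∑-distrib-+ (f i) (g i)))
                         (∑-distrib-+ (λ i → sum (f i)) (λ i → sum (g i)))

∣p∣≡∑𝟙 : ∀ {n} (p : Subset n) → ∣ p ∣ ≡ sum (𝟙 ∘ lookup p)
∣p∣≡∑𝟙 []          = refl
∣p∣≡∑𝟙 (true ∷ p)  = cong suc (∣p∣≡∑𝟙 p)
∣p∣≡∑𝟙 (false ∷ p) = ∣p∣≡∑𝟙 p

lookup-─ : ∀ {n} (p q : Subset n) i → lookup (p ─ q) i ≡ lookup p i ∧ not (lookup q i)
lookup-─ (x ∷ p) (true  ∷ q) fzero    = sym (∧-zeroʳ x)
lookup-─ (x ∷ p) (false ∷ q) fzero    = sym (∧-identityʳ x)
lookup-─ (x ∷ p) (y     ∷ q) (fsuc i) = lookup-─ p q i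

∑ᴹ : ∀ {a} {A : Set a} → Maybe A → (A → ℕ) → ℕ
∑ᴹ m f = maybe′ f 0 m

module _ {a} {A : Set a} where

  ∑ᴹ-cong : ∀ m {f g : A → ℕ} → (∀ x → f x ≡ g x) → ∑ᴹ m f ≡ ∑ᴹ m g
  ∑ᴹ-cong (just x) f≡g = f≡g x
  ∑ᴹ-cong nothing  f≡g = refl

  ∑ᴹ-mono-≤ : ∀ m {f g : A → ℕ} → (∀ x → f x ≤ g x) → ∑ᴹ m f ≤ ∑ᴹ m g
  ∑ᴹ-mono-≤ (just x) f≤g = f≤g x
  ∑ᴹ-mono-≤ nothing  f≤g = z≤n

  ∑ᴹ-zero : ∀ m {f : A → ℕ} → (∀ x → f x ≡ 0) → ∑ᴹ m f ≡ 0
  ∑ᴹ-zero (just x) f≡0 = f≡0 x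
  ∑ᴹ-zero nothing  f≡0 = refl

  ∑ᴹ-distrib-+ : ∀ m (f g : A → ℕ) → ∑ᴹ m (λ x → f x + g x) ≡ ∑ᴹ m f + ∑ᴹ m g
  ∑ᴹ-distrib-+ (just x) f g = refl
  ∑ᴹ-distrib-+ nothing  f g = refl

  *-distribˡ-∑ᴹ : ∀ c m (f : A → ℕ) → c * ∑ᴹ m f ≡ ∑ᴹ m (λ x → c * f x)
  *-distribˡ-∑ᴹ c (just x) f = refl
  *-distribˡ-∑ᴹ c nothing  f = *-zeroʳ c

  ∑ᴹ-∑-comm : ∀ {n} m (F : A → Fin n → ℕ) → ∑ᴹ m (sum ∘ F) ≡ sum (λ u → ∑ᴹ m (λ x → F x u))
  ∑ᴹ-∑-comm     (just x) F = refl
  ∑ᴹ-∑-comm {n} nothing  F = sym (sum-replicate-zero n)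

module Edges {n} (G : Graph n) where

  -- each edge {i, j} is indexed once, by i < j, as in the vertex set SubV of a subdivision
  IsEdge : Fin n → Fin n → Set
  IsEdge i j = i <ᶠ j × adj G i j ≡ true

  isEdge? : ∀ i j → Maybe (IsEdge i j)
  isEdge? i j = dec⇒maybe (i Fin.<? j ×-dec adj G i j Bool.≟ true)

  IsEdge-irrelevant : ∀ {i j} (p q : IsEdge i j) → p ≡ q
  IsEdge-irrelevant (lt , e) (lt′ , e′) =
    cong₂ _,_ (Fin.<-irrelevant lt lt′) (Decidable⇒UIP.≡-irrelevant Bool._≟_ e e′)

  isEdge?-just : ∀ {i j} (p : IsEdge i j) → isEdge? i j ≡ just p
  isEdge?-just {i} {j} p with i Fin.<? j ×-dec adj G i j Bool.≟ true
  ... | yes q = cong just (IsEdge-irrelevant q p)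
  ... | no ¬p = contradiction p ¬p

  isEdge?-nothing : ∀ {i j} → ¬ IsEdge i j → isEdge? i j ≡ nothing
  isEdge?-nothing {i} {j} ¬p with i Fin.<? j ×-dec adj G i j Bool.≟ true
  ... | yes p = contradiction p ¬p
  ... | no _  = refl

  EdgeFun : Set
  EdgeFun = (i j : Fin n) → IsEdge i j → ℕ

  ∑ᴱ : EdgeFun → ℕ
  ∑ᴱ Φ = sum λ i → sum λ j → ∑ᴹ (isEdge? i j) (Φ i j)

  ∑ᴱ-cong : {Φ Ψ : EdgeFun} → (∀ i j p → Φ i j p ≡ Ψ i j p) → ∑ᴱ Φ ≡ ∑ᴱ Ψ
  ∑ᴱ-cong Φ≡Ψ = sum-cong-≗ λ i → sum-cong-≗ λ j → ∑ᴹ-cong (isEdge? i j) (Φ≡Ψ i j)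

  ∑ᴱ-zero : {Φ : EdgeFun} → (∀ i j p → Φ i j p ≡ 0) → ∑ᴱ Φ ≡ 0
  ∑ᴱ-zero Φ≡0 = sum-zero λ i → sum-zero λ j → ∑ᴹ-zero (isEdge? i j) (Φ≡0 i j)

  ∑ᴱ-mono-≤ : {Φ Ψ : EdgeFun} → (∀ i j p → Φ i j p ≤ Ψ i j p) → ∑ᴱ Φ ≤ ∑ᴱ Ψ
  ∑ᴱ-mono-≤ Φ≤Ψ = sum-mono-≤ λ i → sum-mono-≤ λ j → ∑ᴹ-mono-≤ (isEdge? i j) (Φ≤Ψ i j)

  ∑ᴱ-distrib-+ : (Φ Ψ : EdgeFun) → ∑ᴱ (λ i j p → Φ i j p + Ψ i j p) ≡ ∑ᴱ Φ + ∑ᴱ Ψ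
  ∑ᴱ-distrib-+ Φ Ψ =
    trans (sum-cong-≗ λ i → sum-cong-≗ λ j → ∑ᴹ-distrib-+ (isEdge? i j) (Φ i j) (Ψ i j))
          (∑∑-distrib-+ (λ i j → ∑ᴹ (isEdge? i j) (Φ i j)) (λ i j → ∑ᴹ (isEdge? i j) (Ψ i j)))

  *-distribˡ-∑ᴱ : ∀ c (Φ : EdgeFun) → c * ∑ᴱ Φ ≡ ∑ᴱ (λ i j p → c * Φ i j p)
  *-distribˡ-∑ᴱ c Φ =
    trans (*-distribˡ-sum c (λ i → sum λ j → ∑ᴹ (isEdge? i j) (Φ i j))) (sum-cong-≗ λ i →
    trans (*-distribˡ-sum c (λ j → ∑ᴹ (isEdge? i j) (Φ i j)))
          (sum-cong-≗ λ j → *-distribˡ-∑ᴹ c (isEdge? i j) (Φ i j)))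

  ∑ᴱ-∑-comm : ∀ {N} (Φ : (i j : Fin n) → IsEdge i j → Fin N → ℕ) →
              ∑ᴱ (λ i j p → sum (Φ i j p)) ≡ sum (λ u → ∑ᴱ (λ i j p → Φ i j p u))
  ∑ᴱ-∑-comm Φ = begin
    ∑ᴱ (λ i j p → sum (Φ i j p))
      ≡⟨ sum-cong-≗ (λ i → sum-cong-≗ λ j → ∑ᴹ-∑-comm (isEdge? i j) (Φ i j)) ⟩
    sum (λ i → sum λ j → sum λ u → ∑ᴹ (isEdge? i j) (λ p → Φ i j p u))
      ≡⟨ sum-cong-≗ (λ i → ∑-comm (λ j u → ∑ᴹ (isEdge? i j) (λ p → Φ i j p u))) ⟩
    sum (λ i → sum λ u → sum λ j → ∑ᴹ (isEdge? i j) (λ p → Φ i j p u))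
      ≡⟨ ∑-comm (λ i u → sum λ j → ∑ᴹ (isEdge? i j) (λ p → Φ i j p u)) ⟩
    sum (λ u → ∑ᴱ (λ i j p → Φ i j p u)) ∎
    where open ≡-Reasoning

  ∑ᴱ-single : (Φ : EdgeFun) {i₀ j₀ : Fin n} (p₀ : IsEdge i₀ j₀) →
              (∀ i j p → i ≢ i₀ ⊎ j ≢ j₀ → Φ i j p ≡ 0) → ∑ᴱ Φ ≡ Φ i₀ j₀ p₀
  ∑ᴱ-single Φ {i₀} {j₀} p₀ Φ≡0 = begin
    ∑ᴱ Φ
      ≡⟨ sum-single _ i₀ (λ i i≢i₀ → sum-zero λ j →
           ∑ᴹ-zero (isEdge? i j) λ p → Φ≡0 i j p (inj₁ i≢i₀)) ⟩
    sum (λ j → ∑ᴹ (isEdge? i₀ j) (Φ i₀ j))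
      ≡⟨ sum-single _ j₀ (λ j j≢j₀ → ∑ᴹ-zero (isEdge? i₀ j) λ p → Φ≡0 i₀ j p (inj₂ j≢j₀)) ⟩
    ∑ᴹ (isEdge? i₀ j₀) (Φ i₀ j₀)
      ≡⟨ cong (λ m → ∑ᴹ m (Φ i₀ j₀)) (isEdge?-just p₀) ⟩
    Φ i₀ j₀ p₀ ∎
    where open ≡-Reasoning

  ∑ᴹ-isEdge-< : ∀ {i j} x → i <ᶠ j → ∑ᴹ (isEdge? i j) (const x) ≡ 𝟙 (adj G i j) * x
  ∑ᴹ-isEdge-< {i} {j} x i<j = with-adj (adj G i j) refl
    where
    with-adj : ∀ b → adj G i j ≡ b → ∑ᴹ (isEdge? i j) (const x) ≡ 𝟙 b * x
    with-adj true  e rewrite isEdge?-just (i<j , e) = sym (+-identityʳ x)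
    with-adj false e rewrite isEdge?-nothing {i} {j} (λ (_ , e′) → contradiction (trans (sym e) e′) λ ())
      = refl

  ∑ᴹ-isEdge-both : ∀ i j x → ∑ᴹ (isEdge? i j) (const x) + ∑ᴹ (isEdge? j i) (const x) ≡ 𝟙 (adj G i j) * x
  ∑ᴹ-isEdge-both i j x with Fin.<-cmp i j
  ... | tri< i<j _ j≮i rewrite isEdge?-nothing {j} {i} (j≮i ∘ proj₁) =
    trans (+-identityʳ _) (∑ᴹ-isEdge-< x i<j)
  ... | tri≈ i≮i refl _ rewrite isEdge?-nothing {i} {i} (i≮i ∘ proj₁) | irrefl G i = refl
  ... | tri> i≮j _ j<i rewrite isEdge?-nothing {i} {j} (i≮j ∘ proj₁) =
    trans (∑ᴹ-isEdge-< x j<i) (cong (λ b → 𝟙 b * x) (adj-sym G j i))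

  ∑ᴱ-both-ends : (H : Fin n → Fin n → ℕ) →
    ∑ᴱ (λ i j _ → H i j + H j i) ≡ sum (λ i → sum λ j → 𝟙 (adj G i j) * H i j)
  ∑ᴱ-both-ends H = begin
    ∑ᴱ (λ i j _ → H i j + H j i)
      ≡⟨ ∑ᴱ-distrib-+ (λ i j _ → H i j) (λ i j _ → H j i) ⟩
    ∑ᴱ (λ i j _ → H i j) + ∑ᴱ (λ i j _ → H j i)
      ≡⟨ cong (∑ᴱ (λ i j _ → H i j) +_) (∑-comm (λ i j → ∑ᴹ (isEdge? i j) (const (H j i)))) ⟩
    ∑ᴱ (λ i j _ → H i j) + sum (λ i → sum λ j → ∑ᴹ (isEdge? j i) (const (H i j)))
      ≡⟨ sym (∑∑-distrib-+ {n} {n} _ _) ⟩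
    sum (λ i → sum λ j → ∑ᴹ (isEdge? i j) (const (H i j)) + ∑ᴹ (isEdge? j i) (const (H i j)))
      ≡⟨ sum-cong-≗ (λ i → sum-cong-≗ λ j → ∑ᴹ-isEdge-both i j (H i j)) ⟩
    sum (λ i → sum λ j → 𝟙 (adj G i j) * H i j) ∎
    where open ≡-Reasoning

  weighted-handshake : ∀ {d} → Regular d G → (F : Fin n → ℕ) →
                       ∑ᴱ (λ i j _ → F i + F j) ≡ d * sum F
  weighted-handshake {d} regular F = begin
    ∑ᴱ (λ i j _ → F i + F j)                   ≡⟨ ∑ᴱ-both-ends (λ i _ → F i) ⟩
    sum (λ i → sum λ j → 𝟙 (adj G i j) * F i)  ≡⟨ sum-cong-≗ weight-times-degree ⟩
    sum (λ i → d * F i)                         ≡⟨ sym (*-distribˡ-sum d F) ⟩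
    d * sum F                                   ∎
    where
    open ≡-Reasoning
    weight-times-degree : ∀ i → sum (λ j → 𝟙 (adj G i j) * F i) ≡ d * F i
    weight-times-degree i = begin
      sum (λ j → 𝟙 (adj G i j) * F i)  ≡⟨ sum-cong-≗ (λ j → *-comm (𝟙 (adj G i j)) (F i)) ⟩
      sum (λ j → F i * 𝟙 (adj G i j))  ≡⟨ sym (*-distribˡ-sum (F i) (𝟙 ∘ adj G i)) ⟩
      F i * sum (𝟙 ∘ adj G i)          ≡⟨ cong (F i *_) (trans (sym (sumF≡sum (𝟙 ∘ adj G i))) (regular i)) ⟩
      F i * d                          ≡⟨ *-comm (F i) d ⟩
      d * F i                          ∎

  boundary≡∑ᴱ : (S : Subset n) → boundary G S ≡ ∑ᴱ (λ i j _ → 𝟙 (lookup S i xor lookup S j))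
  boundary≡∑ᴱ S = begin
    boundary G S
      ≡⟨ trans (sumF≡sum {n} _) (sum-cong-≗ λ i → out-degree i (lookup S i)) ⟩
    sum (λ i → sum λ j → 𝟙 (adj G i j) * 𝟙 (lookup S i ∧ not (lookup S j)))
      ≡⟨ sym (∑ᴱ-both-ends (λ i j → 𝟙 (lookup S i ∧ not (lookup S j)))) ⟩
    ∑ᴱ (λ i j _ → 𝟙 (lookup S i ∧ not (lookup S j)) + 𝟙 (lookup S j ∧ not (lookup S i)))
      ≡⟨ ∑ᴱ-cong (λ i j _ → 𝟙-xor (lookup S i) (lookup S j)) ⟩
    ∑ᴱ (λ i j _ → 𝟙 (lookup S i xor lookup S j)) ∎
    where
    open ≡-Reasoning
    out-degree : ∀ i b → (if b then countB (λ j → adj G i j ∧ not (lookup S j)) else 0)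
                         ≡ sum (λ j → 𝟙 (adj G i j) * 𝟙 (b ∧ not (lookup S j)))
    out-degree i true  = trans (sumF≡sum {n} _) (sum-cong-≗ λ j → 𝟙-∧ (adj G i j) (not (lookup S j)))
    out-degree i false = sym (sum-zero λ j → *-zeroʳ (𝟙 (adj G i j)))

module Subdivision {n} (G : Graph n) (k : Fin n → Fin n → ℕ) where
  open Edges G

  inner : ∀ i j → IsEdge i j → Fin (k i j) → SubV G k
  inner i j p t = inj₂ (i , j , proj₁ p , proj₂ p , t)

  inner-ends : ∀ {i j p t i′ j′ p′ t′} → inner i j p t ≡ inner i′ j′ p′ t′ → i ≡ i′ × j ≡ j′
  inner-ends refl = refl , refl

  inner-injective : ∀ {i j p t t′} → inner i j p t ≡ inner i j p t′ → t ≡ t′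
  inner-injective refl = refl

  ∑ⱽ : (SubV G k → ℕ) → ℕ
  ∑ⱽ F = sum (F ∘ inj₁) + ∑ᴱ (λ i j p → sum (F ∘ inner i j p))

  ∑ⱽ-cong : {F H : SubV G k → ℕ} → (∀ x → F x ≡ H x) → ∑ⱽ F ≡ ∑ⱽ H
  ∑ⱽ-cong F≡H = cong₂ _+_ (sum-cong-≗ (F≡H ∘ inj₁))
                          (∑ᴱ-cong λ i j p → sum-cong-≗ (F≡H ∘ inner i j p))

  ∑ⱽ-∑-comm : ∀ {N} (F : SubV G k → Fin N → ℕ) →
              ∑ⱽ (λ x → sum (F x)) ≡ sum (λ u → ∑ⱽ (λ x → F x u))
  ∑ⱽ-∑-comm {N} F = begin
    ∑ⱽ (λ x → sum (F x))
      ≡⟨ cong₂ _+_ (∑-comm (F ∘ inj₁)) (trans (∑ᴱ-cong λ i j p → ∑-comm (F ∘ inner i j p))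
                                              (∑ᴱ-∑-comm λ i j p u → sum λ t → F (inner i j p t) u)) ⟩
    sum (λ u → sum λ i → F (inj₁ i) u) + sum (λ u → ∑ᴱ (λ i j p → sum λ t → F (inner i j p t) u))
      ≡⟨ sym (∑-distrib-+ {N} _ _) ⟩
    sum (λ u → ∑ⱽ (λ x → F x u)) ∎
    where open ≡-Reasoning

  ∑ⱽ-single : (F : SubV G k → ℕ) (x₀ : SubV G k) → (∀ x → x ≢ x₀ → F x ≡ 0) → ∑ⱽ F ≡ F x₀
  ∑ⱽ-single F (inj₁ i₀) F≡0 =
    trans (cong₂ _+_ (sum-single (F ∘ inj₁) i₀ λ i i≢i₀ → F≡0 (inj₁ i) λ { refl → i≢i₀ refl })
                     (∑ᴱ-zero λ i j p → sum-zero λ t → F≡0 (inner i j p t) λ ()))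
          (+-identityʳ (F (inj₁ i₀)))
  ∑ⱽ-single F (inj₂ (i₀ , j₀ , lt₀ , e₀ , t₀)) F≡0 =
    cong₂ _+_ (sum-zero λ i → F≡0 (inj₁ i) λ ())
              (trans (∑ᴱ-single _ (lt₀ , e₀) off-edge)
                     (sum-single _ t₀ λ t t≢t₀ →
                        F≡0 (inner i₀ j₀ (lt₀ , e₀) t) (t≢t₀ ∘ inner-injective)))
    where
    off-edge : ∀ i j p → i ≢ i₀ ⊎ j ≢ j₀ → sum (F ∘ inner i j p) ≡ 0
    off-edge i j p (inj₁ i≢i₀) = sum-zero λ t → F≡0 (inner i j p t) (i≢i₀ ∘ proj₁ ∘ inner-ends)
    off-edge i j p (inj₂ j≢j₀) = sum-zero λ t → F≡0 (inner i j p t) (j≢j₀ ∘ proj₂ ∘ inner-ends)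

  ∑-reindex : ∀ {N} (f : Fin N ↔ SubV G k) (w : Fin N → ℕ) → sum w ≡ ∑ⱽ (w ∘ Inverse.from f)
  -- Both sides are the double sum of δ x u = [from x ≡ u] · w u, taken in the two orders.
  ∑-reindex {N} f w = begin
    sum w                            ≡⟨ sum-cong-≗ (λ u → sym (at-to u)) ⟩
    sum (λ u → ∑ⱽ (λ x → δ x u))     ≡⟨ sym (∑ⱽ-∑-comm δ) ⟩
    ∑ⱽ (λ x → sum (δ x))             ≡⟨ ∑ⱽ-cong (λ x → trans (sum-single (δ x) (from x) (δ-off x))
                                                            (δ-on x refl)) ⟩
    ∑ⱽ (w ∘ from)                    ∎
    where
    open ≡-Reasoning
    open Inverse f using (to; from; strictlyInverseˡ; strictlyInverseʳ)
    δ : SubV G k → Fin N → ℕ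
    δ x u = if does (from x Fin.≟ u) then w u else 0
    δ-on : ∀ x {u} → from x ≡ u → δ x u ≡ w u
    δ-on x {u} eq with from x Fin.≟ u
    ... | yes _ = refl
    ... | no ne = contradiction eq ne
    δ-off : ∀ x u → u ≢ from x → δ x u ≡ 0
    δ-off x u ne with from x Fin.≟ u
    ... | yes eq = contradiction (sym eq) ne
    ... | no _   = refl
    at-to : ∀ u → ∑ⱽ (λ x → δ x u) ≡ w u
    at-to u = trans (∑ⱽ-single (λ x → δ x u) (to u) λ x x≢ →
                       δ-off x u λ eq → x≢ (trans (sym (strictlyInverseˡ x)) (cong to (sym eq))))
                    (δ-on (to u) (strictlyInverseʳ u))

-- A separation seen through its vertex sets: an edge leaving the complement of A is an edge of B.
module Sides {N} (H : Graph N) (A B : Fin N → Bool)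
             (cover : ∀ u → A u ≡ true ⊎ B u ≡ true)
             (outside-A⇒B : ∀ u v → adj H u v ≡ true → A u ≡ false → B v ≡ true) where

  X B∖A A∖B : Fin N → Bool
  X u   = A u ∧ B u
  B∖A u = B u ∧ not (A u)
  A∖B u = A u ∧ not (B u)

  A-constant-on-edge : ∀ {u v} → adj H u v ≡ true → X u ≡ false → X v ≡ false → A u ≡ A v
  A-constant-on-edge {u} {v} uv = bool-step (A u) (A v) (B u) (B v)
    (outside-A⇒B u v uv) (outside-A⇒B v u (trans (adj-sym H v u) uv))
    where
    bool-step : ∀ a a′ b b′ → (a ≡ false → b′ ≡ true) → (a′ ≡ false → b ≡ true) →
                a ∧ b ≡ false → a′ ∧ b′ ≡ false → a ≡ a′
    bool-step true  true  _ _  _    _    _  _  = refl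
    bool-step false false _ _  _    _    _  _  = refl
    bool-step true  false b _  _    a′⇒b ab _  = contradiction (trans (sym (a′⇒b refl)) ab) λ ()
    bool-step false true  _ b′ a⇒b′ _    _  a′b′ = contradiction (trans (sym (a⇒b′ refl)) a′b′) λ ()

  A-constant-on-walk : (q : ℕ → Fin N) (L : ℕ) →
    (∀ r → r < L → adj H (q r) (q (suc r)) ≡ true) → (∀ r → r ≤ L → X (q r) ≡ false) →
    ∀ r → r ≤ L → A (q r) ≡ A (q 0)
  A-constant-on-walk q L walk X-free zero    _   = refl
  A-constant-on-walk q L walk X-free (suc r) r<L =
    trans (sym (A-constant-on-edge (walk r r<L) (X-free r (<⇒≤ r<L)) (X-free (suc r) r<L)))
          (A-constant-on-walk q L walk X-free r (<⇒≤ r<L))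

  B∖A≡not-A : ∀ u → B∖A u ≡ not (A u)
  B∖A≡not-A u with A u | cover u
  ... | true  | _       = ∧-zeroʳ (B u)
  ... | false | inj₂ Bu = cong (_∧ true) Bu
  ... | false | inj₁ ()

  B∖A∧A∖B≡false : ∀ u → B∖A u ∧ A∖B u ≡ false
  B∖A∧A∖B≡false u with A u | B u
  ... | true  | true  = refl
  ... | true  | false = refl
  ... | false | true  = refl
  ... | false | false = refl

  partition : ∀ u → 𝟙 (A∖B u) + 𝟙 (B∖A u) + 𝟙 (X u) ≡ 1
  partition u with A u | B u | cover u
  ... | true  | true  | _ = refl
  ... | true  | false | _ = refl
  ... | false | true  | _ = refl
  ... | false | false | inj₁ ()
  ... | false | false | inj₂ ()

module EdgePaths {n N} (G : Graph n) (k : Fin n → Fin n → ℕ) (H : Graph N) (f : Fin N ↔ SubV G k)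
                 (adj⇔ : ∀ u v → (adj H u v ≡ true) ⇔ SubAdj G k (Inverse.to f u) (Inverse.to f v))
                 where
  open Edges G
  open Subdivision G k
  open Inverse f using (to; from; strictlyInverseˡ)

  module _ (i j : Fin n) (p : IsEdge i j) where

    -- positions past the end of the path are clamped to j
    position : ℕ → SubV G k
    position zero = inj₁ i
    position (suc r) with r <? k i j
    ... | yes r<k = inner i j p (fromℕ< r<k)
    ... | no _    = inj₁ j

    path : ℕ → Fin N
    path = from ∘ position

    position-OnPath : ∀ r → r ≤ suc (k i j) → OnPath G k i j (position r) r
    position-OnPath zero    _ = start
    position-OnPath (suc r) r≤k with r <? k i j
    ... | yes r<k = subst (OnPath G k i j _) (cong suc (Fin.toℕ-fromℕ< r<k))
                          (mid (proj₁ p) (proj₂ p) (fromℕ< r<k))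
    ... | no r≮k with ≤-antisym (s≤s⁻¹ r≤k) (≮⇒≥ r≮k)
    ...   | refl = end

    path-adj : ∀ r → r < suc (k i j) → adj H (path r) (path (suc r)) ≡ true
    path-adj r r<k = Equivalence.from (adj⇔ (path r) (path (suc r)))
      (subst₂ (SubAdj G k) (sym (strictlyInverseˡ (position r))) (sym (strictlyInverseˡ (position (suc r))))
        (i , j , proj₁ p , proj₂ p , r , suc r ,
         position-OnPath r (m≤n⇒m≤1+n (s≤s⁻¹ r<k)) , position-OnPath (suc r) r<k , inj₁ refl))

    path-inner : ∀ t → path (suc (toℕ t)) ≡ from (inner i j p t)
    path-inner t with toℕ t <? k i j
    ... | yes t<k = cong (from ∘ inner i j p) (Fin.fromℕ<-toℕ t t<k)
    ... | no t≮k  = contradiction (Fin.toℕ<n t) t≮k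

    path-end : path (suc (k i j)) ≡ from (inj₁ j)
    path-end with k i j <? k i j
    ... | yes k<k = contradiction k<k (<-irrefl refl)
    ... | no _    = refl

ℕtoℚᵘ : ℕ → ℚᵘ
ℕtoℚᵘ x = mkℚᵘ (ℤ.+ x) 0

toℚᵘ-ℕtoℚ : ∀ x → toℚᵘ (ℕtoℚ x) ≃ᵘ ℕtoℚᵘ x
toℚᵘ-ℕtoℚ x = ℚ.toℚᵘ-fromℚᵘ (ℕtoℚᵘ x)

ℕtoℚ-homo-+ : ∀ x y → ℕtoℚ (x + y) ≡ ℕtoℚ x ℚ.+ ℕtoℚ y
ℕtoℚ-homo-+ x y = ℚ.toℚᵘ-injective (begin-equality
  toℚᵘ (ℕtoℚ (x + y))                  ≃⟨ toℚᵘ-ℕtoℚ (x + y) ⟩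
  ℕtoℚᵘ (x + y)                        ≃⟨ *≡* (trans (cong (ℤ._* ℤ.+ 1) (ℤ.pos-+ x y)) (lemma (ℤ.+ x) (ℤ.+ y))) ⟩
  ℕtoℚᵘ x ℚᵘ.+ ℕtoℚᵘ y                   ≃⟨ ℚᵘ.+-cong (toℚᵘ-ℕtoℚ x) (toℚᵘ-ℕtoℚ y) ⟨
  toℚᵘ (ℕtoℚ x) ℚᵘ.+ toℚᵘ (ℕtoℚ y)       ≃⟨ ℚ.toℚᵘ-homo-+ (ℕtoℚ x) (ℕtoℚ y) ⟨
  toℚᵘ (ℕtoℚ x ℚ.+ ℕtoℚ y)               ∎)
  where
  open ℚᵘ.≤-Reasoning
  lemma : ∀ a b → (a ℤ.+ b) ℤ.* (ℤ.+ 1) ≡ (a ℤ.* (ℤ.+ 1) ℤ.+ b ℤ.* (ℤ.+ 1)) ℤ.* (ℤ.+ 1)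
  lemma = ℤ.solve-∀

ℕtoℚ-homo-* : ∀ x y → ℕtoℚ (x * y) ≡ ℕtoℚ x ℚ.* ℕtoℚ y
ℕtoℚ-homo-* x y = ℚ.toℚᵘ-injective (begin-equality
  toℚᵘ (ℕtoℚ (x * y))                  ≃⟨ toℚᵘ-ℕtoℚ (x * y) ⟩
  ℕtoℚᵘ (x * y)                        ≃⟨ *≡* (cong (ℤ._* ℤ.+ 1) (ℤ.pos-* x y)) ⟩
  ℕtoℚᵘ x ℚᵘ.* ℕtoℚᵘ y                   ≃⟨ ℚᵘ.*-cong (toℚᵘ-ℕtoℚ x) (toℚᵘ-ℕtoℚ y) ⟨
  toℚᵘ (ℕtoℚ x) ℚᵘ.* toℚᵘ (ℕtoℚ y)       ≃⟨ ℚ.toℚᵘ-homo-* (ℕtoℚ x) (ℕtoℚ y) ⟨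
  toℚᵘ (ℕtoℚ x ℚ.* ℕtoℚ y)               ∎)
  where open ℚᵘ.≤-Reasoning

ℕtoℚ-mono-≤ : ∀ {x y} → x ≤ y → ℕtoℚ x ≤ℚ ℕtoℚ y
ℕtoℚ-mono-≤ {x} {y} x≤y = ℚ.toℚᵘ-cancel-≤ (begin
  toℚᵘ (ℕtoℚ x)  ≃⟨ toℚᵘ-ℕtoℚ x ⟩
  ℕtoℚᵘ x        ≤⟨ *≤* (ℤ.*-monoʳ-≤-nonNeg (ℤ.+ 1) (ℤ.+≤+ x≤y)) ⟩
  ℕtoℚᵘ y        ≃⟨ toℚᵘ-ℕtoℚ y ⟨
  toℚᵘ (ℕtoℚ y)  ∎)
  where open ℚᵘ.≤-Reasoning

ℕtoℚ-nonNeg : ∀ x → NonNegative (ℕtoℚ x)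
ℕtoℚ-nonNeg x = ℚ.normalize-nonNeg x 1

half+half : ∀ x → ℤ.+ x / 2 ℚ.+ ℤ.+ x / 2 ≡ ℕtoℚ x
half+half x = ℚ.toℚᵘ-injective (begin-equality
  toℚᵘ (ℤ.+ x / 2 ℚ.+ ℤ.+ x / 2)               ≃⟨ ℚ.toℚᵘ-homo-+ (ℤ.+ x / 2) (ℤ.+ x / 2) ⟩
  toℚᵘ (ℤ.+ x / 2) ℚᵘ.+ toℚᵘ (ℤ.+ x / 2)       ≃⟨ ℚᵘ.+-cong (ℚ.toℚᵘ-fromℚᵘ x/2) (ℚ.toℚᵘ-fromℚᵘ x/2) ⟩
  x/2 ℚᵘ.+ x/2                             ≃⟨ *≡* (lemma (ℤ.+ x)) ⟩
  ℕtoℚᵘ x                                  ≃⟨ toℚᵘ-ℕtoℚ x ⟨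
  toℚᵘ (ℕtoℚ x)                            ∎)
  where
  open ℚᵘ.≤-Reasoning
  x/2 : ℚᵘ
  x/2 = mkℚᵘ (ℤ.+ x) 1
  lemma : ∀ a → (a ℤ.* (ℤ.+ 2) ℤ.+ a ℤ.* (ℤ.+ 2)) ℤ.* (ℤ.+ 1) ≡ a ℤ.* (ℤ.+ 4)
  lemma = ℤ.solve-∀

p≤p+q : ∀ p q .{{_ : NonNegative q}} → p ≤ℚ p ℚ.+ q
p≤p+q p q = ℚ.≤-trans (ℚ.≤-reflexive (sym (ℚ.+-identityʳ p))) (ℚ.+-monoʳ-≤ p (ℚ.nonNegative⁻¹ q))

p≤q*r⇒p÷r≤q : ∀ {p q} r .{{_ : Positive r}} → p ≤ℚ q ℚ.* r → (p ℚ.÷ r) {{ℚ.pos⇒nonZero r}} ≤ℚ q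
p≤q*r⇒p÷r≤q {p} {q} r p≤qr = begin
  p ℚ.* 1/ r          ≤⟨ ℚ.*-monoʳ-≤-nonNeg (1/ r) {{ℚ.pos⇒nonNeg (1/ r) {{ℚ.1/pos⇒pos r}}}} p≤qr ⟩
  q ℚ.* r ℚ.* 1/ r    ≡⟨ ℚ.*-assoc q r (1/ r) ⟩
  q ℚ.* (r ℚ.* 1/ r)  ≡⟨ cong (q ℚ.*_) (ℚ.*-inverseʳ r) ⟩
  q ℚ.* ℚ.1ℚ          ≡⟨ ℚ.*-identityʳ q ⟩
  q                   ∎
  where
  open ℚ.≤-Reasoning
  instance r≢0 = ℚ.pos⇒nonZero r

module _ (α : ℚ) .{{_ : Positive α}} (m : ℕ) where

  private instance
    α≢0 = ℚ.pos⇒nonZero α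

  denom-positive : Positive (denom α m)
  denom-positive =
    ℚ.pos*pos⇒pos (factor₁ α m ℚ.* factor₂ α m) {{ℚ.pos*pos⇒pos (factor₁ α m) (factor₂ α m) {{factor₂-pos}}}}
                  (factor₃ α m) {{factor₃-pos}}
    where
    factor₂-pos : Positive (factor₂ α m)
    factor₂-pos = ℚ.pos+nonNeg⇒pos (ℕtoℚ 1) (ℤ.+ (3 * m) / 2) {{ℚ.normalize-nonNeg (3 * m) 2}}
    factor₃-pos : Positive (factor₃ α m)
    factor₃-pos = ℚ.pos+pos⇒pos (sixOverα α m) {{ℚ.pos*pos⇒pos (ℕtoℚ 6) (1/ α) {{ℚ.1/pos⇒pos α}}}} (ℕtoℚ 2)

  -- 3(1 + 3m/2)(6/α + 2) = 3(2 + 3m)(3/α + 1) exceeds the factor 3(1 + 3m)(3/α + 1) obtained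
  -- combinatorially by exactly 3(3/α + 1), the slack below.
  bound≤ℕtoℚ : ∀ N T s → α ℚ.* ℕtoℚ T ≤ℚ ℕtoℚ (3 * s) →
               N ≤ 3 * (1 + 3 * m) * (T + s) → bound α m N ≤ℚ ℕtoℚ s
  bound≤ℕtoℚ N T s αT≤3s N≤ = p≤q*r⇒p÷r≤q (denom α m) {{denom-positive}} (begin
    ℕtoℚ N                               ≤⟨ ℕtoℚ-mono-≤ N≤ ⟩
    ℕtoℚ (3 * (1 + 3 * m) * (T + s))     ≡⟨ trans (ℕtoℚ-homo-* (3 * (1 + 3 * m)) (T + s))
                                                  (cong (K ℚ.*_) (ℕtoℚ-homo-+ T s)) ⟩
    K ℚ.* (τ ℚ.+ σ)                      ≤⟨ ℚ.*-monoˡ-≤-nonNeg K {{ℕtoℚ-nonNeg (3 * (1 + 3 * m))}}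
                                                                   (ℚ.+-monoˡ-≤ σ τ≤) ⟩
    K ℚ.* (β ℚ.* (c 3 ℚ.* σ) ℚ.+ σ)      ≤⟨ p≤p+q _ slack {{slack-nonNeg}} ⟩
    K ℚ.* (β ℚ.* (c 3 ℚ.* σ) ℚ.+ σ) ℚ.+ slack
                                         ≡⟨ cong (λ x → x ℚ.* (β ℚ.* (c 3 ℚ.* σ) ℚ.+ σ) ℚ.+ slack) K≡ ⟩
    c 3 ℚ.* (c 1 ℚ.+ (h ℚ.+ h)) ℚ.* (β ℚ.* (c 3 ℚ.* σ) ℚ.+ σ) ℚ.+ slack
                                         ≡⟨ regroup h β σ ⟩
    σ ℚ.* denom α m                      ∎)
    where
    open ℚ.≤-Reasoning
    c : ℕ → ℚ
    c = ℕtoℚ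
    τ σ β h K slack : ℚ
    τ = c T
    σ = c s
    β = 1/ α
    h = ℤ.+ (3 * m) / 2
    K = c (3 * (1 + 3 * m))
    slack = c 9 ℚ.* (σ ℚ.* β) ℚ.+ c 3 ℚ.* σ

    β-nonNeg : NonNegative β
    β-nonNeg = ℚ.pos⇒nonNeg β {{ℚ.1/pos⇒pos α}}

    slack-nonNeg : NonNegative slack
    slack-nonNeg = ℚ.nonNeg+nonNeg⇒nonNeg (c 9 ℚ.* (σ ℚ.* β)) {{9σβ-nonNeg}} (c 3 ℚ.* σ) {{3σ-nonNeg}}
      where
      σβ-nonNeg = ℚ.nonNeg*nonNeg⇒nonNeg σ {{ℕtoℚ-nonNeg s}} β {{β-nonNeg}}
      9σβ-nonNeg = ℚ.nonNeg*nonNeg⇒nonNeg (c 9) {{ℕtoℚ-nonNeg 9}} (σ ℚ.* β) {{σβ-nonNeg}}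
      3σ-nonNeg = ℚ.nonNeg*nonNeg⇒nonNeg (c 3) {{ℕtoℚ-nonNeg 3}} σ {{ℕtoℚ-nonNeg s}}

    τ≤ : τ ≤ℚ β ℚ.* (c 3 ℚ.* σ)
    τ≤ = subst₂ _≤ℚ_ βατ≡τ (cong (β ℚ.*_) (ℕtoℚ-homo-* 3 s)) (ℚ.*-monoˡ-≤-nonNeg β {{β-nonNeg}} αT≤3s)
      where
      βατ≡τ : β ℚ.* (α ℚ.* τ) ≡ τ
      βατ≡τ = trans (sym (ℚ.*-assoc β α τ)) (trans (cong (ℚ._* τ) (ℚ.*-inverseˡ α)) (ℚ.*-identityˡ τ))

    K≡ : K ≡ c 3 ℚ.* (c 1 ℚ.+ (h ℚ.+ h))
    K≡ = trans (ℕtoℚ-homo-* 3 (1 + 3 * m))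
               (cong (c 3 ℚ.*_) (trans (ℕtoℚ-homo-+ 1 (3 * m)) (cong (c 1 ℚ.+_) (sym (half+half (3 * m))))))

    open +-*-Solver
    regroup : ∀ h β σ → c 3 ℚ.* (c 1 ℚ.+ (h ℚ.+ h)) ℚ.* (β ℚ.* (c 3 ℚ.* σ) ℚ.+ σ)
                          ℚ.+ (c 9 ℚ.* (σ ℚ.* β) ℚ.+ c 3 ℚ.* σ)
                        ≡ σ ℚ.* (c 3 ℚ.* (c 1 ℚ.+ h) ℚ.* (c 6 ℚ.* β ℚ.+ c 2))
    regroup = solve 3 (λ h β σ →
        con (c 3) :* (con (c 1) :+ (h :+ h)) :* (β :* (con (c 3) :* σ) :+ σ)
          :+ (con (c 9) :* (σ :* β) :+ con (c 3) :* σ)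
      := σ :* (con (c 3) :* (con (c 1) :+ h) :* (con (c 6) :* β :+ con (c 2)))) refl

module Estimates {n N} (G : Graph n) (k : Fin n → Fin n → ℕ) (H : Graph N) (f : Fin N ↔ SubV G k)
                 (adj⇔ : ∀ u v → (adj H u v ≡ true) ⇔ SubAdj G k (Inverse.to f u) (Inverse.to f v))
                 (A B : Fin N → Bool) (cover : ∀ u → A u ≡ true ⊎ B u ≡ true)
                 (outside-A⇒B : ∀ u v → adj H u v ≡ true → A u ≡ false → B v ≡ true) where
  open Edges G
  open Subdivision G k
  open EdgePaths G k H f adj⇔
  open Sides H A B cover outside-A⇒B public
  open Inverse f using (from)

  S : Fin n → Bool
  S i = B∖A (from (inj₁ i))

  separatorCount : EdgeFun
  separatorCount i j p = 𝟙 (X (from (inj₁ i))) + 𝟙 (X (from (inj₁ j)))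
                       + sum (λ t → 𝟙 (X (from (inner i j p t))))

  separatorCount≡0⇒X-free : ∀ {i j} p → separatorCount i j p ≡ 0 →
    X (from (inj₁ i)) ≡ false × X (from (inj₁ j)) ≡ false × (∀ t → X (from (inner i j p t)) ≡ false)
  separatorCount≡0⇒X-free {i} {j} p none =
    𝟙≡0⇒false (m+n≡0⇒m≡0 _ ends) , 𝟙≡0⇒false (m+n≡0⇒n≡0 (𝟙 (X (from (inj₁ i)))) ends) ,
    λ t → 𝟙≡0⇒false (sum≡0⇒zero _ (m+n≡0⇒n≡0 (𝟙 (X (from (inj₁ i))) + 𝟙 (X (from (inj₁ j)))) none) t)
    where
    ends : 𝟙 (X (from (inj₁ i))) + 𝟙 (X (from (inj₁ j))) ≡ 0
    ends = m+n≡0⇒m≡0 _ none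

  module _ {i j} (p : IsEdge i j) (no-separator : separatorCount i j p ≡ 0) where

    path-X-free : ∀ r → r ≤ suc (k i j) → X (path i j p r) ≡ false
    path-X-free zero    _ = proj₁ (separatorCount≡0⇒X-free p no-separator)
    path-X-free (suc r) _ with r <? k i j
    ... | yes r<k = proj₂ (proj₂ (separatorCount≡0⇒X-free p no-separator)) (fromℕ< r<k)
    ... | no _    = proj₁ (proj₂ (separatorCount≡0⇒X-free p no-separator))

    B∖A-constant : ∀ r → r ≤ suc (k i j) → B∖A (path i j p r) ≡ S i
    B∖A-constant r r≤k = begin
      B∖A (path i j p r)      ≡⟨ B∖A≡not-A _ ⟩
      not (A (path i j p r))  ≡⟨ cong not (A-constant-on-walk (path i j p) (suc (k i j))
                                             (path-adj i j p) path-X-free r r≤k) ⟩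
      not (A (path i j p 0))  ≡⟨ sym (B∖A≡not-A _) ⟩
      S i                     ∎
      where open ≡-Reasoning

  crossing≤separatorCount : ∀ i j p → 𝟙 (S i xor S j) ≤ separatorCount i j p
  crossing≤separatorCount i j p =
    subst (𝟙 (S i xor S j) ≤_) (*-identityˡ (separatorCount i j p))
      (a≤m∧[c≡0⇒a≡0]⇒a≤m*c 1 (separatorCount i j p) (𝟙≤1 (S i xor S j)) λ none → begin
      𝟙 (S i xor S j)     ≡⟨ cong (λ b → 𝟙 (S i xor b)) (sym (cong B∖A (path-end i j p))) ⟩
      𝟙 (S i xor B∖A (path i j p (suc (k i j))))
                          ≡⟨ cong (λ b → 𝟙 (S i xor b)) (B∖A-constant p none (suc (k i j)) ≤-refl) ⟩
      𝟙 (S i xor S i)     ≡⟨ cong 𝟙 (xor-same (S i)) ⟩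
      0                   ∎)
    where open ≡-Reasoning

  inner-B∖A≤ : ∀ {m} → (∀ i j → k i j ≤ m) → ∀ i j p →
               sum (λ t → 𝟙 (B∖A (from (inner i j p t)))) ≤ m * (𝟙 (S i) + separatorCount i j p)
  inner-B∖A≤ {m} k≤m i j p =
    a≤m∧[c≡0⇒a≡0]⇒a≤m*c m (𝟙 (S i) + separatorCount i j p) (≤-trans (∑𝟙≤n _) (k≤m i j)) λ none →
      sum-zero λ t → cong 𝟙 (begin
        B∖A (from (inner i j p t))     ≡⟨ cong B∖A (sym (path-inner i j p t)) ⟩
        B∖A (path i j p (suc (toℕ t))) ≡⟨ B∖A-constant p (m+n≡0⇒n≡0 (𝟙 (S i)) none) (suc (toℕ t))
                                                        (s≤s (<⇒≤ (Fin.toℕ<n t))) ⟩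
        S i                            ≡⟨ 𝟙≡0⇒false (m+n≡0⇒m≡0 _ none) ⟩
        false                          ∎)
    where open ≡-Reasoning

  |S| |X| |A∖B| |B∖A| : ℕ
  |S|   = sum (𝟙 ∘ S)
  |X|   = sum (𝟙 ∘ X)
  |A∖B| = sum (𝟙 ∘ A∖B)
  |B∖A| = sum (𝟙 ∘ B∖A)

  module _ {d} .{{_ : ℕ.NonZero d}} (regular : Regular d G) where

    ∑ᴱ-separatorCount≤ : ∑ᴱ separatorCount ≤ d * |X|
    ∑ᴱ-separatorCount≤ = begin
      ∑ᴱ separatorCount
        ≡⟨ ∑ᴱ-distrib-+ (λ i j _ → 𝟙 (X (from (inj₁ i))) + 𝟙 (X (from (inj₁ j)))) X-inner ⟩
      ∑ᴱ (λ i j _ → 𝟙 (X (from (inj₁ i))) + 𝟙 (X (from (inj₁ j)))) + ∑ᴱ X-inner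
        ≡⟨ cong (_+ ∑ᴱ X-inner) (weighted-handshake regular (𝟙 ∘ X ∘ from ∘ inj₁)) ⟩
      d * sum (𝟙 ∘ X ∘ from ∘ inj₁) + ∑ᴱ X-inner
        ≤⟨ +-monoʳ-≤ (d * sum (𝟙 ∘ X ∘ from ∘ inj₁)) (m≤n*m (∑ᴱ X-inner) d) ⟩
      d * sum (𝟙 ∘ X ∘ from ∘ inj₁) + d * ∑ᴱ X-inner
        ≡⟨ sym (*-distribˡ-+ d _ _) ⟩
      d * ∑ⱽ (𝟙 ∘ X ∘ from)
        ≡⟨ cong (d *_) (sym (∑-reindex f (𝟙 ∘ X))) ⟩
      d * |X| ∎
      where
      open ≤-Reasoning
      X-inner : EdgeFun
      X-inner i j p = sum (λ t → 𝟙 (X (from (inner i j p t))))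

    boundary≤ : boundary G (tabulate S) ≤ d * |X|
    boundary≤ = begin
      boundary G (tabulate S)
        ≡⟨ boundary≡∑ᴱ (tabulate S) ⟩
      ∑ᴱ (λ i j _ → 𝟙 (lookup (tabulate S) i xor lookup (tabulate S) j))
        ≡⟨ ∑ᴱ-cong (λ i j _ → cong₂ (λ a b → 𝟙 (a xor b)) (lookup∘tabulate S i) (lookup∘tabulate S j)) ⟩
      ∑ᴱ (λ i j _ → 𝟙 (S i xor S j))
        ≤⟨ ∑ᴱ-mono-≤ crossing≤separatorCount ⟩
      ∑ᴱ separatorCount
        ≤⟨ ∑ᴱ-separatorCount≤ ⟩
      d * |X| ∎
      where open ≤-Reasoning

    |B∖A|≤ : ∀ {m} → (∀ i j → k i j ≤ m) → |B∖A| ≤ |S| + m * (d * |S| + d * |X|)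
    |B∖A|≤ {m} k≤m = begin
      |B∖A|
        ≡⟨ ∑-reindex f (𝟙 ∘ B∖A) ⟩
      |S| + ∑ᴱ (λ i j p → sum (λ t → 𝟙 (B∖A (from (inner i j p t)))))
        ≤⟨ +-monoʳ-≤ |S| (∑ᴱ-mono-≤ (inner-B∖A≤ k≤m)) ⟩
      |S| + ∑ᴱ (λ i j p → m * (𝟙 (S i) + separatorCount i j p))
        ≡⟨ cong (|S| +_) (trans (sym (*-distribˡ-∑ᴱ m _))
                                (cong (m *_) (∑ᴱ-distrib-+ (λ i j _ → 𝟙 (S i)) separatorCount))) ⟩
      |S| + m * (∑ᴱ (λ i j _ → 𝟙 (S i)) + ∑ᴱ separatorCount)
        ≤⟨ +-monoʳ-≤ |S| (*-monoʳ-≤ m (+-mono-≤ S-ends ∑ᴱ-separatorCount≤)) ⟩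
      |S| + m * (d * |S| + d * |X|) ∎
      where
      open ≤-Reasoning
      S-ends : ∑ᴱ (λ i j _ → 𝟙 (S i)) ≤ d * |S|
      S-ends = ≤-trans (∑ᴱ-mono-≤ λ i j _ → m≤m+n (𝟙 (S i)) (𝟙 (S j)))
                       (≤-reflexive (weighted-handshake regular (𝟙 ∘ S)))

    balanced⇒N≤ : ∀ {m} → (∀ i j → k i j ≤ m) → 3 * |A∖B| ≤ 2 * N → N ≤ 3 * (1 + d * m) * (|S| + |X|)
    balanced⇒N≤ {m} k≤m balanced = begin
      N                                  ≡⟨ N≡ ⟩
      |A∖B| + (|B∖A| + |X|)              ≤⟨ 3a≤2[a+b]⇒a+b≤3b |A∖B| (|B∖A| + |X|)
                                              (subst (λ x → 3 * |A∖B| ≤ 2 * x) N≡ balanced) ⟩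
      3 * (|B∖A| + |X|)                  ≤⟨ *-monoʳ-≤ 3 (+-monoˡ-≤ |X| (|B∖A|≤ k≤m)) ⟩
      3 * (|S| + m * (d * |S| + d * |X|) + |X|) ≡⟨ regroup |S| m d |X| ⟩
      3 * (1 + d * m) * (|S| + |X|)      ∎
      where
      open ≤-Reasoning
      regroup : ∀ s m d x → 3 * (s + m * (d * s + d * x) + x) ≡ 3 * (1 + d * m) * (s + x)
      regroup = solve-∀
      N≡ : N ≡ |A∖B| + (|B∖A| + |X|)
      N≡ = begin-equality
        N  ≡⟨ sym (∑1≡n N) ⟩
        sum {N} (const 1)  ≡⟨ sum-cong-≗ (sym ∘ partition) ⟩
        sum (λ u → 𝟙 (A∖B u) + 𝟙 (B∖A u) + 𝟙 (X u))
          ≡⟨ trans (∑-distrib-+ (λ u → 𝟙 (A∖B u) + 𝟙 (B∖A u)) (𝟙 ∘ X))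
                   (cong (_+ |X|) (∑-distrib-+ (𝟙 ∘ A∖B) (𝟙 ∘ B∖A))) ⟩
        |A∖B| + |B∖A| + |X|  ≡⟨ +-assoc |A∖B| |B∖A| |X| ⟩
        |A∖B| + (|B∖A| + |X|) ∎

  separator-bound : ∀ α .{{_ : Positive α}} m → Regular 3 G → Expander α G → (∀ i j → k i j ≤ m) →
                    3 * |A∖B| ≤ 2 * N → 2 * |S| ≤ n → bound α m N ≤ℚ ℕtoℚ |X|
  separator-bound α m regular expander k≤m balanced small =
    bound≤ℕtoℚ α m N |S| |X| (ℚ.≤-trans αS≤boundary (ℕtoℚ-mono-≤ (boundary≤ regular)))
                             (balanced⇒N≤ regular k≤m balanced)
    where
    ∣S∣≡|S| : ∣ tabulate S ∣ ≡ |S|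
    ∣S∣≡|S| = trans (∣p∣≡∑𝟙 (tabulate S)) (sum-cong-≗ (cong 𝟙 ∘ lookup∘tabulate S))
    αS≤boundary : α ℚ.* ℕtoℚ |S| ≤ℚ ℕtoℚ (boundary G (tabulate S))
    αS≤boundary = subst (λ x → α ℚ.* ℕtoℚ x ≤ℚ ℕtoℚ (boundary G (tabulate S))) ∣S∣≡|S|
                        (expander (tabulate S) (subst (λ x → 2 * x ≤ n) (sym ∣S∣≡|S|) small))

module SeparationSides {N} {H : Graph N} (sep : Separation H) where

  A B : Fin N → Bool
  A = lookup (VA sep)
  B = lookup (VB sep)

  A-or-B : ∀ u → A u ≡ true ⊎ B u ≡ true
  A-or-B u = Sum.map []=⇒lookup []=⇒lookup (cover-V sep u)

  outside-A⇒B : ∀ u v → adj H u v ≡ true → A u ≡ false → B v ≡ true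
  outside-A⇒B u v uv Au≡false with cover-E sep u v uv
  ... | inj₁ uv∈EA = contradiction (trans (sym ([]=⇒lookup (proj₁ (EA-ends sep u v uv∈EA)))) Au≡false) λ ()
  ... | inj₂ uv∈EB = []=⇒lookup (proj₂ (EB-ends sep u v uv∈EB))

  outside-B⇒A : ∀ u v → adj H u v ≡ true → B u ≡ false → A v ≡ true
  outside-B⇒A u v uv Bu≡false with cover-E sep u v uv
  ... | inj₁ uv∈EA = []=⇒lookup (proj₂ (EA-ends sep u v uv∈EA))
  ... | inj₂ uv∈EB = contradiction (trans (sym ([]=⇒lookup (proj₁ (EB-ends sep u v uv∈EB)))) Bu≡false) λ ()

  size≡∑𝟙 : size sep ≡ sum (λ u → 𝟙 (A u ∧ B u))
  size≡∑𝟙 = trans (∣p∣≡∑𝟙 (VA sep ∩ VB sep))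
                  (sum-cong-≗ λ u → cong 𝟙 (lookup-zipWith _∧_ u (VA sep) (VB sep)))

  ∣─∣≡∑𝟙 : ∀ (P Q : Subset N) → ∣ P ─ Q ∣ ≡ sum (λ u → 𝟙 (lookup P u ∧ not (lookup Q u)))
  ∣─∣≡∑𝟙 P Q = trans (∣p∣≡∑𝟙 (P ─ Q)) (sum-cong-≗ λ u → cong 𝟙 (lookup-─ P Q u))

lemma29 : (α : ℚ) .{{_ : Positive α}} (n m : ℕ) → 1 ≤ n → 1 ≤ m →
          (G : Graph n) → Regular 3 G → Expander α G →
          (n' : ℕ) (G' : Graph n') → IsSubdivision m G G' →
          (s : Separation G') → Balanced s →
          bound α m n' ≤ℚ ℕtoℚ (size s)
-- the bound holds without the hypotheses 1 ≤ n and 1 ≤ m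
lemma29 α n m _ _ G regular expander N G′ (k , k≤m , f , adj⇔) sep (A∖B-small , B∖A-small) =
  subst (λ x → bound α m N ≤ℚ ℕtoℚ x) (sym size≡∑𝟙)
        ([ AB-bound , BA-bound ]′ (a+b≤n⇒2a≤n⊎2b≤n AB.|S| BA.|S| (∑𝟙+∑𝟙≤n AB.S BA.S S-disjoint)))
  where
  open SeparationSides sep
  module AB = Estimates G k G′ f adj⇔ A B A-or-B outside-A⇒B
  module BA = Estimates G k G′ f adj⇔ B A (swap ∘ A-or-B) outside-B⇒A

  S-disjoint : ∀ i → AB.S i ∧ BA.S i ≡ false
  S-disjoint i = AB.B∖A∧A∖B≡false (Inverse.from f (inj₁ i))

  AB-bound : 2 * AB.|S| ≤ n → bound α m N ≤ℚ ℕtoℚ AB.|X|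
  AB-bound = AB.separator-bound α m regular expander k≤m
    (subst (λ x → 3 * x ≤ 2 * N) (∣─∣≡∑𝟙 (VA sep) (VB sep)) A∖B-small)

  BA-bound : 2 * BA.|S| ≤ n → bound α m N ≤ℚ ℕtoℚ AB.|X|
  BA-bound small = subst (λ x → bound α m N ≤ℚ ℕtoℚ x) (sum-cong-≗ λ u → cong 𝟙 (∧-comm (B u) (A u)))
    (BA.separator-bound α m regular expander k≤m
      (subst (λ x → 3 * x ≤ 2 * N) (∣─∣≡∑𝟙 (VB sep) (VA sep)) B∖A-small) small)
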